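{- Let $\Sigma$, $\Gamma$, a data stream $\mathbf D$, $t\geq1$ and a program $\mathcal P$ be as in the context. The Fitting operator $\Phi_{\mathcal P,\mathbf D,t}$ is monotone with respect to the precision ordering: for all 3-valued streams $(\mathbf I,\mathbf J)$ and $(\mathbf I',\mathbf J')$ with $(\mathbf I,\mathbf J)\subseteq_p(\mathbf I',\mathbf J')$, we have $\Phi_{\mathcal P,\mathbf D,t}(\mathbf I,\mathbf J)\subseteq\Phi_{\mathcal P,\mathbf D,t}(\mathbf I',\mathbf J')$.
   Context: $\Sigma$ is a finite nonempty set of propositional atoms containing a special symbol $\top$. Formulas: $\alpha::=a\mid\neg\alpha\mid\alpha\land\alpha\mid\alpha\lor\alpha\mid\alpha\rightarrow\alpha\mid\Diamond\alpha\mid\Box\alpha\mid @_{t'}\alpha\mid\boxplus_{[\ell,r]}\alpha$ with $a\in\Sigma$, integer $t'\geq1$, $\ell,r\in\mathbb N\cup\{\infty\}$, $\ell\leq r$. Normal: none of $\neg,\lor,\rightarrow,\Diamond$. A stream is $\mathbf I=I_1I_2\ldots$ with $I_s\subseteq\Sigma$; $\subseteq$, $\cup$ pointwise; $\{a\}_s$ has $\{a\}$ at $s$, $\emptyset$ elsewhere. $\mathrm{supp}\,\mathbf I$: tightest interval containing $\{s\mid I_s\neq\emptyset\}$, empty for the all-empty stream. $\mathbf I[\ell,r;s]$ agrees with $\mathbf I$ at $u$ with $s-\ell\leq u\leq s+r$, empty elsewhere. Fix $\Gamma\subseteq\Sigma$. Entailment: $\mathbf I,s\models_\Gamma\top$;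 for $a\neq\top$, $\mathbf I,s\models_\Gamma a$ iff $a\in I_s\cup\Gamma$; $\neg,\land,\lor,\rightarrow$ classically; $\Diamond\alpha$/$\Box\alpha$ at $s$ iff $\alpha$ at some/every $s'\in\mathrm{supp}\,\mathbf I$; $@_{s'}\alpha$ at $s$ iff $\alpha$ at $s'$; $\mathbf I,s\models_\Gamma\boxplus_{[\ell,r]}\alpha$ iff $\mathbf I[\ell,r;s],s\models_\Gamma\alpha$. Partial model operator: $\mathrm M_{\mathbf I,s}(a)=\{a\}_s$ if $a\notin\Gamma$, $\emptyset$ if $a\in\Gamma$; $\mathrm M_{\mathbf I,s}(\alpha\land\beta)=\mathrm M_{\mathbf I,s}(\alpha)\cup\mathrm M_{\mathbf I,s}(\beta)$; $\mathrm M_{\mathbf I,s}(\Box\alpha)=\bigcup_{s'\in\mathrm{supp}\,\mathbf I}\mathrm M_{\mathbf I,s'}(\alpha)$; $\mathrm M_{\mathbf I,s}(@_{s'}\alpha)=\mathrm M_{\mathbf I,s'}(\alpha)$; $\mathrm M_{\mathbf I,s}(\boxplus_{[\ell,r]}\alpha)=\mathrm M_{\mathbf I[\ell,r;s],s}(\alpha)$; for finite sets $A$, $\mathrm M_{\mathbf I,s}(A)=\bigcup_{\alpha\in A}\mathrm M_{\mathbf I,s}(\alpha)$. $\mathrm{MM}_{\mathbf I,s}(X)=\mathrm M_{\mathrm M_{\mathbf I,s}(X),s}(X)$. A program $\mathcal P$ is a finite nonempty set of rules $\rho$: $\alpha\leftarrow\beta_1,\ldots,\beta_j,{\sim}\beta_{j+1},\ldots,{\sim}\beta_k$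 ($k\geq j\geq1$), $\alpha$ a normal formula assumed $t$-consistent (satisfied at $t$ by some stream), $\beta_i$ formulas; $\mathrm H(\rho)=\alpha$, $\mathrm B(\rho)=\beta_1\land\cdots\land\beta_j\land\neg\beta_{j+1}\land\cdots\land\neg\beta_k$. $\mathbf D$ is a fixed data stream. A 3-valued stream is a pair $(\mathbf I,\mathbf J)$ of streams with $\mathbf I\subseteq\mathbf J$; $(\mathbf I,\mathbf J)\subseteq_p(\mathbf I',\mathbf J')$ iff $\mathbf I\subseteq\mathbf I'$ and $\mathbf J'\subseteq\mathbf J$; $(\mathbf I,\mathbf J),t\models_\Gamma\alpha$ iff $\mathbf K,t\models_\Gamma\alpha$ for all $\mathbf K$ with $\mathbf I\subseteq\mathbf K\subseteq\mathbf J$. $\Phi_{\mathcal P,\mathbf D,t}(\mathbf I,\mathbf J)=\mathbf D\cup\mathrm{MM}_{\mathbf I,t}(\{\mathrm H(\rho)\mid\rho\in\mathcal P,\ (\mathbf I,\mathbf J),t\models_\Gamma\mathrm B(\rho)\})$. -}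

module Defs where

open import Level using (Level; _⊔_; 0ℓ; Lift) renaming (suc to lsuc)
open import Data.Nat using (ℕ; suc; _≤_; _+_)
open import Data.Fin using (Fin; zero; _≟_)
open import Data.Product using (Σ; _×_; _,_)
open import Data.Sum using (_⊎_)
open import Data.Unit using (⊤)
open import Data.List using (List; []; _∷_; map; _++_)
open import Data.List.NonEmpty using (List⁺; toList) renaming (head to head⁺; tail to tail⁺)
open import Data.List.Membership.Propositional using (_∈_)
open import Relation.Nullary using (¬_; Dec; yes; no)
open import Relation.Binary.PropositionalEquality using (_≡_)

-- Conventions:
--  * Σ = Fin (suc n), the special atom ⊤ is `zero`.
--  * Time points are shifted by one: position k : ℕ stands for time k+1.
--    So streams are ℕ → (subsets of Σ), with index 0 = time 1, and
--    t ≥ 1 / @_{t'} with t' ≥ 1 become arbitrary naturals.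
--  * Subsets of Σ are predicates Atom → Set ℓ (universe polymorphic,
--    since 3-valued entailment quantifies over all streams).

Atom : ℕ → Set
Atom n = Fin (suc n)

top : ∀ {n} → Atom n
top = zero

data ℕ∞ : Set where
  fin : ℕ → ℕ∞
  ∞   : ℕ∞

data _≤∞_ : ℕ∞ → ℕ∞ → Set where
  fin≤fin : ∀ {m k} → m ≤ k → fin m ≤∞ fin k
  ≤∞-∞    : ∀ x → x ≤∞ ∞

data Formula (n : ℕ) : Set where
  atom  : Atom n → Formula n
  ¬′_   : Formula n → Formula n
  _∧′_  : Formula n → Formula n → Formula n
  _∨′_  : Formula n → Formula n → Formula n
  _⇒′_  : Formula n → Formula n → Formula n
  ◇′_   : Formula n → Formula n
  □′_   : Formula n → Formula n
  at′    : ℕ → Formula n → Formula n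
  ⊞′    : (l r : ℕ∞) → l ≤∞ r → Formula n → Formula n

data NFormula (n : ℕ) : Set where
  natom : Atom n → NFormula n
  _∧ₙ_  : NFormula n → NFormula n → NFormula n
  □ₙ_   : NFormula n → NFormula n
  atₙ    : ℕ → NFormula n → NFormula n
  ⊞ₙ    : (l r : ℕ∞) → l ≤∞ r → NFormula n → NFormula n

⌜_⌝ : ∀ {n} → NFormula n → Formula n
⌜ natom a ⌝     = atom a
⌜ α ∧ₙ β ⌝      = ⌜ α ⌝ ∧′ ⌜ β ⌝
⌜ □ₙ α ⌝        = □′ ⌜ α ⌝
⌜ atₙ k α ⌝      = at′ k ⌜ α ⌝
⌜ ⊞ₙ l r p α ⌝  = ⊞′ l r p ⌜ α ⌝

Stream : ∀ {a} → ℕ → Set (lsuc a)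
Stream {a} n = ℕ → Atom n → Set a

_⊆_ : ∀ {a b n} → Stream {a} n → Stream {b} n → Set (a ⊔ b)
I ⊆ J = ∀ s x → I s x → J s x

_∪_ : ∀ {a b n} → Stream {a} n → Stream {b} n → Stream {a ⊔ b} n
(I ∪ J) s x = I s x ⊎ J s x

-- s ∈ supp I  (tightest interval containing the non-empty positions)
InSupp : ∀ {a n} → Stream {a} n → ℕ → Set a
InSupp {n = n} I s =
  (Σ ℕ λ u → u ≤ s × Σ (Atom n) (I u)) × (Σ ℕ λ v → s ≤ v × Σ (Atom n) (I v))

-- window bounds: s - l ≤ u  and  u ≤ s + r
Low : ℕ∞ → ℕ → ℕ → Set
Low (fin l) s u = s ≤ u + l
Low ∞       s u = ⊤

High : ℕ∞ → ℕ → ℕ → Set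
High (fin r) s u = u ≤ s + r
High ∞       s u = ⊤

window : ∀ {a n} → ℕ∞ → ℕ∞ → ℕ → Stream {a} n → Stream {a} n
window l r s I u x = Low l s u × High r s u × I u x

AtomSat : ∀ {a n} → Stream {a} n → (Atom n → Set) → ℕ → (x : Atom n) → Dec (x ≡ top) → Set a
AtomSat {a} I Γ s x (yes _) = Lift a ⊤
AtomSat     I Γ s x (no _)  = I s x ⊎ Γ x

Sat : ∀ {a n} → (Γ : Atom n → Set) → Stream {a} n → ℕ → Formula n → Set a
Sat Γ I s (atom x)      = AtomSat I Γ s x (x ≟ top)
Sat Γ I s (¬′ α)        = ¬ Sat Γ I s α
Sat Γ I s (α ∧′ β)      = Sat Γ I s α × Sat Γ I s β
Sat Γ I s (α ∨′ β)      = Sat Γ I s α ⊎ Sat Γ I s β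
Sat Γ I s (α ⇒′ β)      = Sat Γ I s α → Sat Γ I s β
Sat Γ I s (◇′ α)        = Σ ℕ λ s′ → InSupp I s′ × Sat Γ I s′ α
Sat Γ I s (□′ α)        = ∀ s′ → InSupp I s′ → Sat Γ I s′ α
Sat Γ I s (at′ k α)      = Sat Γ I k α
Sat Γ I s (⊞′ l r _ α)  = Sat Γ (window l r s I) s α

_⊆p_ : ∀ {n} → (Stream {0ℓ} n × Stream {0ℓ} n) → (Stream {0ℓ} n × Stream {0ℓ} n) → Set
(I , J) ⊆p (I′ , J′) = I ⊆ I′ × J′ ⊆ J

Sat3 : ∀ {n} → (Γ : Atom n → Set) → Stream {0ℓ} n → Stream {0ℓ} n → ℕ → Formula n → Set₁
Sat3 Γ I J t α = (K : Stream {0ℓ} _) → I ⊆ K → K ⊆ J → Sat Γ K t α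

M : ∀ {a n} → (Γ : Atom n → Set) → Stream {a} n → ℕ → NFormula n → Stream {a} n
M {a} Γ I s (natom b) u x     = Lift a (u ≡ s × x ≡ b × ¬ Γ b)
M Γ I s (α ∧ₙ β) u x          = M Γ I s α u x ⊎ M Γ I s β u x
M Γ I s (□ₙ α) u x            = Σ ℕ λ s′ → InSupp I s′ × M Γ I s′ α u x
M Γ I s (atₙ k α) u x          = M Γ I k α u x
M Γ I s (⊞ₙ l r _ α) u x      = M Γ (window l r s I) s α u x

MSet : ∀ {a b n} → (Γ : Atom n → Set) → Stream {a} n → ℕ → (NFormula n → Set b) → Stream {a ⊔ b} n
MSet {n = n} Γ I s X u x = Σ (NFormula n) λ α → X α × M Γ I s α u x

MM : ∀ {a b n} → (Γ : Atom n → Set) → Stream {a} n → ℕ → (NFormula n → Set b) → Stream {a ⊔ b} n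
MM Γ I s X = MSet Γ (MSet Γ I s X) s X

record Rule (n : ℕ) : Set where
  constructor rule
  field
    H   : NFormula n
    pos : List⁺ (Formula n)
    neg : List (Formula n)

conj : ∀ {n} → Formula n → List (Formula n) → Formula n
conj φ []       = φ
conj φ (ψ ∷ ψs) = conj (φ ∧′ ψ) ψs

B : ∀ {n} → Rule n → Formula n
B ρ = conj (head⁺ (Rule.pos ρ)) (tail⁺ (Rule.pos ρ) ++ map ¬′_ (Rule.neg ρ))

Program : ℕ → Set
Program n = List⁺ (Rule n)

TConsistent : ∀ {n} → (Atom n → Set) → ℕ → NFormula n → Set₁
TConsistent Γ t α = Σ (Stream {0ℓ} _) λ K → Sat Γ K t ⌜ α ⌝

HeadsConsistent : ∀ {n} → (Atom n → Set) → ℕ → Program n → Set₁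
HeadsConsistent Γ t P = ∀ ρ → ρ ∈ toList P → TConsistent Γ t (Rule.H ρ)

ActiveHeads : ∀ {n} → (Atom n → Set) → Program n → ℕ → Stream {0ℓ} n → Stream {0ℓ} n → NFormula n → Set₁
ActiveHeads {n} Γ P t I J α =
  Σ (Rule n) λ ρ → ρ ∈ toList P × Rule.H ρ ≡ α × Sat3 Γ I J t (B ρ)

Φ : ∀ {n} → (Atom n → Set) → Program n → Stream {0ℓ} n → ℕ → Stream {0ℓ} n → Stream {0ℓ} n → Stream {lsuc 0ℓ} n
Φ Γ P D t I J = D ∪ MM Γ I t (ActiveHeads Γ P t I J)

module Submission where

open import Defs
open import Level using (0ℓ; lift; lower)
open import Data.Nat using (ℕ)
open import Data.Product using (_,_)
open import Data.Sum using (inj₁; inj₂)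

-- The stream enters M only through supports and windows, both monotone, so M is
-- monotone in the stream; and a body true in every completion of (I , J) is true in
-- every completion of the more precise (I′ , J′), so the set of active heads grows.

InSupp-mono : ∀ {a b n} {I : Stream {a} n} {I′ : Stream {b} n} → I ⊆ I′ → ∀ s → InSupp I s → InSupp I′ s
InSupp-mono I⊆I′ s ((u , u≤s , x , Iux) , (v , s≤v , y , Ivy)) =
  (u , u≤s , x , I⊆I′ u x Iux) , (v , s≤v , y , I⊆I′ v y Ivy)

window-mono : ∀ {a b n} {I : Stream {a} n} {I′ : Stream {b} n} → I ⊆ I′ → ∀ l r s → window l r s I ⊆ window l r s I′
window-mono I⊆I′ l r s u x (low , high , Iux) = low , high , I⊆I′ u x Iux

M-mono : ∀ {a b n} (Γ : Atom n → Set) {I : Stream {a} n} {I′ : Stream {b} n} → I ⊆ I′ → ∀ s α → M Γ I s α ⊆ M Γ I′ s α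
M-mono Γ I⊆I′ s (natom c)     u x m               = lift (lower m)
M-mono Γ I⊆I′ s (α ∧ₙ β)      u x (inj₁ m)        = inj₁ (M-mono Γ I⊆I′ s α u x m)
M-mono Γ I⊆I′ s (α ∧ₙ β)      u x (inj₂ m)        = inj₂ (M-mono Γ I⊆I′ s β u x m)
M-mono Γ I⊆I′ s (□ₙ α)        u x (s′ , s′∈ , m)  = s′ , InSupp-mono I⊆I′ s′ s′∈ , M-mono Γ I⊆I′ s′ α u x m
M-mono Γ I⊆I′ s (atₙ k α)     u x m               = M-mono Γ I⊆I′ k α u x m
M-mono Γ I⊆I′ s (⊞ₙ l r _ α)  u x m               = M-mono Γ (window-mono I⊆I′ l r s) s α u x m

MSet-mono : ∀ {a b c d n} (Γ : Atom n → Set) {I : Stream {a} n} {I′ : Stream {b} n}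
  {X : NFormula n → Set c} {X′ : NFormula n → Set d} →
  I ⊆ I′ → (∀ α → X α → X′ α) → ∀ s → MSet Γ I s X ⊆ MSet Γ I′ s X′
MSet-mono Γ I⊆I′ X⊆X′ s u x (α , α∈X , m) = α , X⊆X′ α α∈X , M-mono Γ I⊆I′ s α u x m

MM-mono : ∀ {a b c d n} (Γ : Atom n → Set) {I : Stream {a} n} {I′ : Stream {b} n}
  {X : NFormula n → Set c} {X′ : NFormula n → Set d} →
  I ⊆ I′ → (∀ α → X α → X′ α) → ∀ s → MM Γ I s X ⊆ MM Γ I′ s X′
MM-mono Γ I⊆I′ X⊆X′ s = MSet-mono Γ (MSet-mono Γ I⊆I′ X⊆X′ s) X⊆X′ s

Sat3-mono : ∀ {n} (Γ : Atom n → Set) {I J I′ J′ : Stream {0ℓ} n} → (I , J) ⊆p (I′ , J′) →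
  ∀ t φ → Sat3 Γ I J t φ → Sat3 Γ I′ J′ t φ
Sat3-mono Γ (I⊆I′ , J′⊆J) t φ sat K I′⊆K K⊆J′ =
  sat K (λ u x Iux → I′⊆K u x (I⊆I′ u x Iux)) (λ u x Kux → J′⊆J u x (K⊆J′ u x Kux))

ActiveHeads-mono : ∀ {n} (Γ : Atom n → Set) (P : Program n) (t : ℕ) {I J I′ J′ : Stream {0ℓ} n} →
  (I , J) ⊆p (I′ , J′) → ∀ α → ActiveHeads Γ P t I J α → ActiveHeads Γ P t I′ J′ α
ActiveHeads-mono Γ P t prec α (ρ , ρ∈P , Hρ≡α , body) = ρ , ρ∈P , Hρ≡α , Sat3-mono Γ prec t (B ρ) body

proposition9 : ∀ {n} (Γ : Atom n → Set) (D : Stream {0ℓ} n) (t : ℕ) (P : Program n)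
    → HeadsConsistent Γ t P
    → (I J I′ J′ : Stream {0ℓ} n)
    → I ⊆ J → I′ ⊆ J′
    → (I , J) ⊆p (I′ , J′)
    → Φ Γ P D t I J ⊆ Φ Γ P D t I′ J′
proposition9 Γ D t P _ I J I′ J′ _ _ _                 u x (inj₁ d) = inj₁ d
proposition9 Γ D t P _ I J I′ J′ _ _ prec@(I⊆I′ , _) u x (inj₂ m) =
  inj₂ (MM-mono Γ I⊆I′ (ActiveHeads-mono Γ P t prec) t u x m)
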